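{- Let $r > s \geq 1$ be integers and $\alpha \in (0,1)$. Then there exist constants $\sigma \in (0,1)$ and $n_3 > 0$ such that for all integers $n \geq n_3$ and $0 \le t \leq \sigma n$, \[ N(n,t,r,s) - \alpha \binom{n-s}{r-s} < N(n-1,t,r,s). \]
   Context: For integers $r \ge s \ge 1$ and $0 \le t \le n$, $N(n,t,r,s) = \binom{n-s+1}{r-s+1} - \binom{n-s+1-t}{r-s+1}$ (equivalently $\sum_{i=1}^{t} \binom{n-s+1-i}{r-s}$).
   Formalization: The parameter α ranges only over rationals in (0,1), and the constant σ is taken in ℚ. -}

module Defs where

open import Data.Nat using (ℕ; _∸_; _+_)
open import Data.Nat.Combinatorics using (_C_)
open import Data.Integer using (+_)
open import Data.Rational using (ℚ; _/_)

-- N(n,t,r,s) = C(n-s+1, r-s+1) - C(n-s+1-t, r-s+1)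
-- (ℕ truncated subtraction; for r ≥ s, t ≤ n the outer difference is
--  nonnegative, and C(m, k) = 0 for m < k, matching the sum form
--  Σ_{i=1}^t C(n-s+1-i, r-s).)
N : ℕ → ℕ → ℕ → ℕ → ℕ
N n t r s = ((n ∸ s + 1) C (r ∸ s + 1)) ∸ ((n ∸ s + 1 ∸ t) C (r ∸ s + 1))

ℕtoℚ : ℕ → ℚ
ℕtoℚ n = (+ n) / 1

-- Write M = n − s and k = r − s ≥ 1. By Pascal's rule the difference
-- N(n,t,r,s) − N(n−1,t,r,s) is C(M,k) − C(M−t,k), the number of k-subsets of an
-- M-set meeting a fixed t-subset. Removing the t points one at a time loses at
-- most C(M−1,k−1) = (k/M)·C(M,k) sets each, so the difference is at most
-- (tk/M)·C(M,k). Since n < 2M once n ≥ r + s, taking σ = α/(2k) makes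
-- tk/M ≤ σnk/M < α.
module Submission where

open import Defs
open import Data.Nat as ℕ using (ℕ; zero; suc; _∸_; _≤_; _<_; _≤′_; z≤n; s≤s)
import Data.Nat.Properties as ℕP
open import Algebra.Properties.CommutativeSemigroup ℕP.*-commutativeSemigroup using (x∙yz≈y∙xz)
open import Data.Nat.Combinatorics using (_C_; nCk+nC[k+1]≡[n+1]C[k+1]; nC1≡n)
import Data.Nat.Coprimality as Coprime
import Data.Nat.Solver
import Data.Integer as ℤ
import Data.Integer.Properties as ℤP
open import Data.Rational as Q using (ℚ; mkℚ; 0ℚ; 1ℚ; _*_; _-_; _+_)
import Data.Rational.Properties as QP
import Data.Rational.Solver
open import Data.Product using (Σ; _×_; _,_; proj₁; proj₂)
open import Relation.Binary.PropositionalEquality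
open import Relation.Nullary using (yes; no)

pascal : ∀ m k → suc m C suc k ≡ m C k ℕ.+ m C suc k
pascal m k = sym (nCk+nC[k+1]≡[n+1]C[k+1] m k)

C-monoˡ-suc : ∀ m k → m C k ≤ suc m C k
C-monoˡ-suc m zero    = ℕP.≤-refl
C-monoˡ-suc m (suc k) = ℕP.≤-trans (ℕP.m≤n+m (m C suc k) (m C k)) (ℕP.≤-reflexive (sym (pascal m k)))

C-monoˡ-≤ : ∀ {m n} k → m ≤ n → m C k ≤ n C k
C-monoˡ-≤ k m≤n = go (ℕP.≤⇒≤′ m≤n)
  where
  go : ∀ {m n} → m ≤′ n → m C k ≤ n C k
  go ℕ.≤′-refl         = ℕP.≤-refl
  go (ℕ.≤′-step {n} p) = ℕP.≤-trans (go p) (C-monoˡ-suc n k)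

k≤n⇒0<nCk : ∀ {n k} → k ≤ n → 0 < n C k
k≤n⇒0<nCk {n}     {zero}  _         = s≤s z≤n
k≤n⇒0<nCk {suc n} {suc k} (s≤s k≤n) =
  ℕP.<-≤-trans (k≤n⇒0<nCk k≤n) (ℕP.≤-trans (ℕP.m≤m+n (n C k) (n C suc k)) (ℕP.≤-reflexive (sym (pascal n k))))

[1+m]*mCk≡[1+k]*[1+m]C[1+k] : ∀ m k → suc m ℕ.* (m C k) ≡ suc k ℕ.* (suc m C suc k)
[1+m]*mCk≡[1+k]*[1+m]C[1+k] zero    zero    = refl
[1+m]*mCk≡[1+k]*[1+m]C[1+k] zero    (suc k) = sym (ℕP.*-zeroʳ (suc (suc k)))
[1+m]*mCk≡[1+k]*[1+m]C[1+k] (suc m) zero    =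
  trans (ℕP.*-identityʳ (suc (suc m))) (sym (trans (ℕP.+-identityʳ _) (nC1≡n (suc (suc m)))))
[1+m]*mCk≡[1+k]*[1+m]C[1+k] (suc m) (suc k) = begin
  suc (suc m) ℕ.* c                                 ≡⟨ cong (λ z → c ℕ.+ suc m ℕ.* z) (pascal m k) ⟩
  c ℕ.+ suc m ℕ.* (m C k ℕ.+ m C suc k)             ≡⟨ cong (c ℕ.+_) (ℕP.*-distribˡ-+ (suc m) (m C k) _) ⟩
  c ℕ.+ (suc m ℕ.* (m C k) ℕ.+ suc m ℕ.* (m C suc k))
    ≡⟨ cong₂ (λ x y → c ℕ.+ (x ℕ.+ y)) ([1+m]*mCk≡[1+k]*[1+m]C[1+k] m k) ([1+m]*mCk≡[1+k]*[1+m]C[1+k] m (suc k)) ⟩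
  c ℕ.+ (suc k ℕ.* c ℕ.+ suc (suc k) ℕ.* e)         ≡⟨ sym (ℕP.+-assoc c (suc k ℕ.* c) _) ⟩
  suc (suc k) ℕ.* c ℕ.+ suc (suc k) ℕ.* e           ≡⟨ sym (ℕP.*-distribˡ-+ (suc (suc k)) c e) ⟩
  suc (suc k) ℕ.* (c ℕ.+ e)                         ≡⟨ cong (suc (suc k) ℕ.*_) (sym (pascal (suc m) (suc k))) ⟩
  suc (suc k) ℕ.* (suc (suc m) C suc (suc k))       ∎
  where
  open ≡-Reasoning
  c e : ℕ
  c = suc m C suc k
  e = suc m C suc (suc k)

[m+n]∸[o+p]≡[m∸o]+[n∸p] : ∀ {m n o p} → o ≤ m → p ≤ n → (m ℕ.+ n) ∸ (o ℕ.+ p) ≡ (m ∸ o) ℕ.+ (n ∸ p)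
[m+n]∸[o+p]≡[m∸o]+[n∸p] {m} {n} {o} {p} o≤m p≤n = begin
  (m ℕ.+ n) ∸ (o ℕ.+ p) ≡⟨ sym (ℕP.∸-+-assoc (m ℕ.+ n) o p) ⟩
  (m ℕ.+ n) ∸ o ∸ p     ≡⟨ cong (_∸ p) (ℕP.+-∸-comm n o≤m) ⟩
  (m ∸ o ℕ.+ n) ∸ p     ≡⟨ ℕP.+-∸-assoc (m ∸ o) p≤n ⟩
  (m ∸ o) ℕ.+ (n ∸ p)   ∎
  where open ≡-Reasoning

-- The number of k-subsets of an m-set that meet a fixed t-subset.
Δ : ℕ → ℕ → ℕ → ℕ
Δ m t k = m C k ∸ (m ∸ t) C k

-- Fails for k = 0 when t > m, since then Δ m t 0 = 0 but Δ (suc m) t 1 = suc m.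
Δ-pascal : ∀ m t k → Δ (suc m) t (suc (suc k)) ≡ Δ m t (suc (suc k)) ℕ.+ Δ m t (suc k)
Δ-pascal m t k with t ℕ.≤? m
... | yes t≤m rewrite ℕP.+-∸-assoc 1 t≤m | pascal m (suc k) | pascal (m ∸ t) (suc k) =
  trans (cong₂ _∸_ (ℕP.+-comm (m C suc k) _) (ℕP.+-comm ((m ∸ t) C suc k) _))
        ([m+n]∸[o+p]≡[m∸o]+[n∸p] (C-monoˡ-≤ (suc (suc k)) (ℕP.m∸n≤m m t)) (C-monoˡ-≤ (suc k) (ℕP.m∸n≤m m t)))
... | no t≰m rewrite ℕP.m≤n⇒m∸n≡0 (ℕP.<⇒≤ (ℕP.≰⇒> t≰m)) | ℕP.m≤n⇒m∸n≡0 (ℕP.≰⇒> t≰m) | pascal m (suc k) =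
  ℕP.+-comm (m C suc k) _

C-∸-suc : ∀ m t k → (m ∸ t) C suc k ≤ (m ∸ suc t) C suc k ℕ.+ (m ∸ 1) C k
C-∸-suc m t k with m ∸ t in m∸t≡1+a
... | zero  = z≤n
... | suc a = begin
  suc a C suc k              ≡⟨ trans (pascal a k) (ℕP.+-comm (a C k) _) ⟩
  a C suc k ℕ.+ a C k        ≤⟨ ℕP.+-mono-≤ (ℕP.≤-reflexive (cong (_C suc k) a≡m∸[1+t])) (C-monoˡ-≤ k a≤m∸1) ⟩
  (m ∸ suc t) C suc k ℕ.+ (m ∸ 1) C k ∎
  where
  open ℕP.≤-Reasoning
  a≡m∸[1+t] : a ≡ m ∸ suc t
  a≡m∸[1+t] = trans (cong ℕ.pred (sym m∸t≡1+a)) (ℕP.pred[m∸n]≡m∸[1+n] m t)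
  a≤m∸1 : a ≤ m ∸ 1
  a≤m∸1 = subst (_≤ m ∸ 1) (sym a≡m∸[1+t]) (ℕP.∸-monoʳ-≤ m (s≤s z≤n))

C-∸-bound : ∀ m k t → m C suc k ≤ (m ∸ t) C suc k ℕ.+ t ℕ.* ((m ∸ 1) C k)
C-∸-bound m k zero    = ℕP.m≤m+n _ _
C-∸-bound m k (suc t) = begin
  m C suc k                                                   ≤⟨ C-∸-bound m k t ⟩
  (m ∸ t) C suc k ℕ.+ t ℕ.* X                                 ≤⟨ ℕP.+-monoˡ-≤ (t ℕ.* X) (C-∸-suc m t k) ⟩
  (m ∸ suc t) C suc k ℕ.+ X ℕ.+ t ℕ.* X                       ≡⟨ ℕP.+-assoc _ X (t ℕ.* X) ⟩
  (m ∸ suc t) C suc k ℕ.+ suc t ℕ.* X                         ∎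
  where
  open ℕP.≤-Reasoning
  X : ℕ
  X = (m ∸ 1) C k

Δ-bound : ∀ m t k → m ℕ.* Δ m t (suc k) ≤ t ℕ.* (suc k ℕ.* (m C suc k))
Δ-bound zero    t k = z≤n
Δ-bound (suc m) t k = begin
  suc m ℕ.* Δ (suc m) t (suc k)      ≤⟨ ℕP.*-monoʳ-≤ (suc m) (ℕP.m≤n+o⇒m∸n≤o _ _ (C-∸-bound (suc m) k t)) ⟩
  suc m ℕ.* (t ℕ.* (m C k))           ≡⟨ x∙yz≈y∙xz (suc m) t (m C k) ⟩
  t ℕ.* (suc m ℕ.* (m C k))           ≡⟨ cong (t ℕ.*_) ([1+m]*mCk≡[1+k]*[1+m]C[1+k] m k) ⟩
  t ℕ.* (suc k ℕ.* (suc m C suc k))   ∎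
  where open ℕP.≤-Reasoning

N≡Δ : ∀ n t r s → N n t r s ≡ Δ (suc (n ∸ s)) t (suc (r ∸ s))
N≡Δ n t r s rewrite ℕP.+-comm (n ∸ s) 1 | ℕP.+-comm (r ∸ s) 1 = refl

N-pred : ∀ {n r s k} t → r ∸ s ≡ suc k → s < n → N n t r s ≡ N (n ∸ 1) t r s ℕ.+ Δ (n ∸ s) t (suc k)
N-pred {n} {r} {s} {k} t r∸s≡1+k s<n = begin
  N n t r s                                                 ≡⟨ N≡Δ n t r s ⟩
  Δ (suc (n ∸ s)) t (suc (r ∸ s))                           ≡⟨ cong (λ j → Δ (suc (n ∸ s)) t (suc j)) r∸s≡1+k ⟩
  Δ (suc (n ∸ s)) t (suc (suc k))                           ≡⟨ Δ-pascal (n ∸ s) t k ⟩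
  Δ (n ∸ s) t (suc (suc k)) ℕ.+ Δ (n ∸ s) t (suc k)         ≡⟨ cong (ℕ._+ Δ (n ∸ s) t (suc k)) (sym N[n-1]) ⟩
  N (n ∸ 1) t r s ℕ.+ Δ (n ∸ s) t (suc k)                   ∎
  where
  open ≡-Reasoning
  suc[n∸1∸s]≡n∸s : suc (n ∸ 1 ∸ s) ≡ n ∸ s
  suc[n∸1∸s]≡n∸s = trans (cong suc (ℕP.∸-+-assoc n 1 s)) (sym (ℕP.+-∸-assoc 1 s<n))
  N[n-1] : N (n ∸ 1) t r s ≡ Δ (n ∸ s) t (suc (suc k))
  N[n-1] = trans (N≡Δ (n ∸ 1) t r s) (cong₂ (λ m j → Δ m t (suc j)) suc[n∸1∸s]≡n∸s r∸s≡1+k)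

ι : ℕ → ℚ
ι = ℕtoℚ

coprime-1 : ∀ n → Coprime.Coprime n 1
coprime-1 n = Coprime.sym (Coprime.1-coprimeTo n)

ι≡mkℚ : ∀ n → ι n ≡ mkℚ (ℤ.+ n) 0 (coprime-1 n)
ι≡mkℚ n = QP.normalize-coprime (coprime-1 n)

ι-mono-≤ : ∀ {m n} → m ≤ n → ι m Q.≤ ι n
ι-mono-≤ {m} {n} m≤n rewrite ι≡mkℚ m | ι≡mkℚ n =
  Q.*≤* (subst₂ ℤ._≤_ (sym (ℤP.*-identityʳ (ℤ.+ m))) (sym (ℤP.*-identityʳ (ℤ.+ n))) (ℤ.+≤+ m≤n))

ι-mono-< : ∀ {m n} → m < n → ι m Q.< ι n
ι-mono-< {m} {n} m<n rewrite ι≡mkℚ m | ι≡mkℚ n =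
  Q.*<* (subst₂ ℤ._<_ (sym (ℤP.*-identityʳ (ℤ.+ m))) (sym (ℤP.*-identityʳ (ℤ.+ n))) (ℤ.+<+ m<n))

ι-homo-+ : ∀ m n → ι (m ℕ.+ n) ≡ ι m + ι n
ι-homo-+ m n rewrite ι≡mkℚ m | ι≡mkℚ n =
  cong (Q._/ 1) (trans (ℤP.pos-+ m n) (sym (cong₂ ℤ._+_ (ℤP.*-identityʳ (ℤ.+ m)) (ℤP.*-identityʳ (ℤ.+ n)))))

ι-homo-* : ∀ m n → ι (m ℕ.* n) ≡ ι m * ι n
ι-homo-* m n rewrite ι≡mkℚ m | ι≡mkℚ n = cong (Q._/ 1) (ℤP.pos-* m n)

ι-nonNeg : ∀ n → Q.NonNegative (ι n)
ι-nonNeg n = Q.nonNegative (ι-mono-≤ (z≤n {n}))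

unitFraction : ℕ → ℚ
unitFraction d = mkℚ (ℤ.+ 1) d (Coprime.1-coprimeTo (suc d))

unitFraction≤1 : ∀ d → unitFraction d Q.≤ 1ℚ
unitFraction≤1 d = Q.*≤* (subst (ℤ._≤_ (ℤ.+ 1)) (sym (ℤP.*-identityˡ (ℤ.+ suc d))) (ℤ.+≤+ (s≤s z≤n)))

*-unitFraction-cancel : ∀ α d → α * unitFraction d * ι (suc d) ≡ α
*-unitFraction-cancel α d = begin
  α * unitFraction d * ι (suc d)    ≡⟨ QP.*-assoc α _ _ ⟩
  α * (unitFraction d * ι (suc d))  ≡⟨ cong (λ q → α * (unitFraction d * q)) (ι≡mkℚ (suc d)) ⟩
  α * (unitFraction d * mkℚ (ℤ.+ suc d) 0 (coprime-1 (suc d))) ≡⟨ cong (α *_) (QP.*-inverseˡ (mkℚ (ℤ.+ suc d) 0 (coprime-1 (suc d)))) ⟩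
  α * 1ℚ                            ≡⟨ QP.*-identityʳ α ⟩
  α                                 ∎
  where open ≡-Reasoning

*-double : ∀ t k c → t ℕ.* (k ℕ.* c) ℕ.+ t ℕ.* (k ℕ.* c) ≡ t ℕ.* ((2 ℕ.* k) ℕ.* c)
*-double = NS.solve 3 (λ t k c → t NS.:* (k NS.:* c) NS.:+ t NS.:* (k NS.:* c) NS.:= t NS.:* ((NS.con 2 NS.:* k) NS.:* c)) refl
  where module NS = Data.Nat.Solver.+-*-Solver

-- With σ = α/(2k), the hypothesis n < 2m is what turns t ≤ σn into tk/m < α.
increment-small : ∀ (α σ : ℚ) {k m n t c y} → 0ℚ Q.< α → σ * ι (2 ℕ.* k) ≡ α →
                  m ℕ.* y ≤ t ℕ.* (k ℕ.* c) → ι t Q.≤ σ * ι n → n < m ℕ.+ m → 0 < c →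
                  ι y Q.< α * ι c
increment-small α σ {k} {m} {n} {t} {c} {y} 0<α σ[2k]≡α my≤tkc t≤σn n<2m 0<c =
  QP.*-cancelˡ-<-nonNeg (ι (m ℕ.+ m)) {{ι-nonNeg (m ℕ.+ m)}} (begin-strict
    ι (m ℕ.+ m) * ι y              ≡⟨ sym (ι-homo-* (m ℕ.+ m) y) ⟩
    ι ((m ℕ.+ m) ℕ.* y)            ≤⟨ ι-mono-≤ 2my≤2tkc ⟩
    ι (t ℕ.* (d ℕ.* c))            ≡⟨ trans (ι-homo-* t (d ℕ.* c)) (cong (ι t *_) (ι-homo-* d c)) ⟩
    ι t * (ι d * ι c)              ≤⟨ QP.*-monoʳ-≤-nonNeg (ι d * ι c) t≤σn ⟩
    (σ * ι n) * (ι d * ι c)        ≡⟨ QS.solve 4 (λ σ n d c → (σ QS.:* n) QS.:* (d QS.:* c) QS.:= (σ QS.:* d) QS.:* c QS.:* n) refl σ (ι n) (ι d) (ι c) ⟩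
    (σ * ι d) * ι c * ι n          ≡⟨ cong (λ q → q * ι c * ι n) σ[2k]≡α ⟩
    (α * ι c) * ι n                <⟨ QP.*-monoʳ-<-pos (α * ι c) (ι-mono-< n<2m) ⟩
    (α * ι c) * ι (m ℕ.+ m)        ≡⟨ QP.*-comm (α * ι c) _ ⟩
    ι (m ℕ.+ m) * (α * ι c)        ∎)
  where
  open QP.≤-Reasoning
  module QS = Data.Rational.Solver.+-*-Solver
  d : ℕ
  d = 2 ℕ.* k
  2my≤2tkc : (m ℕ.+ m) ℕ.* y ≤ t ℕ.* (d ℕ.* c)
  2my≤2tkc = ℕP.≤-trans (ℕP.≤-reflexive (ℕP.*-distribʳ-+ y m m))
               (ℕP.≤-trans (ℕP.+-mono-≤ my≤tkc my≤tkc) (ℕP.≤-reflexive (*-double t k c)))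
  instance
    α-pos : Q.Positive α
    α-pos = Q.positive 0<α
    c-pos : Q.Positive (ι c)
    c-pos = Q.positive (ι-mono-< 0<c)
    αc-pos : Q.Positive (α * ι c)
    αc-pos = QP.pos*pos⇒pos α (ι c)
    dc-nonNeg : Q.NonNegative (ι d * ι c)
    dc-nonNeg = subst Q.NonNegative (ι-homo-* d c) (ι-nonNeg (d ℕ.* c))

ι-increment< : ∀ {a b y} (β : ℚ) → a ≡ b ℕ.+ y → ι y Q.< β → ι a - β Q.< ι b
ι-increment< {b = b} {y} β refl y<β = begin-strict
  ι (b ℕ.+ y) - β       ≡⟨ cong (_- β) (ι-homo-+ b y) ⟩
  (ι b + ι y) - β       <⟨ QP.+-monoˡ-< (Q.- β) (QP.+-monoʳ-< (ι b) y<β) ⟩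
  (ι b + β) - β         ≡⟨ trans (QP.+-assoc (ι b) β (Q.- β)) (trans (cong (ι b +_) (QP.+-inverseʳ β)) (QP.+-identityʳ (ι b))) ⟩
  ι b                   ∎
  where open QP.≤-Reasoning

N-increment< : ∀ {n r s k t} (α σ : ℚ) → 0ℚ Q.< α → σ * ι (2 ℕ.* suc k) ≡ α →
               r ∸ s ≡ suc k → s < r → r ℕ.+ s ≤ n → ι t Q.≤ σ * ι n →
               ι (N n t r s) - α * ι ((n ∸ s) C suc k) Q.< ι (N (n ∸ 1) t r s)
N-increment< {n} {r} {s} {k} {t} α σ 0<α σ[2k]≡α r∸s≡1+k s<r r+s≤n t≤σn =
  ι-increment< {b = N (n ∸ 1) t r s} {y = Δ M t (suc k)} (α * ι (M C suc k)) (N-pred t r∸s≡1+k s<n)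
    (increment-small α σ {suc k} {M} {n} {t} 0<α σ[2k]≡α (Δ-bound M t k) t≤σn n<M+M (k≤n⇒0<nCk 1+k≤M))
  where
  M : ℕ
  M = n ∸ s
  r≤M : r ≤ M
  r≤M = ℕP.m+n≤o⇒m≤o∸n r r+s≤n
  1+k≤M : suc k ≤ M
  1+k≤M = ℕP.≤-trans (ℕP.≤-reflexive (sym r∸s≡1+k)) (ℕP.≤-trans (ℕP.m∸n≤m r s) r≤M)
  s<n : s < n
  s<n = ℕP.<-≤-trans (ℕP.<-≤-trans s<r r≤M) (ℕP.m∸n≤m n s)
  n<M+M : n < M ℕ.+ M
  n<M+M = subst (_< M ℕ.+ M) (ℕP.m∸n+n≡m (ℕP.<⇒≤ s<n)) (ℕP.+-monoʳ-< M (ℕP.<-≤-trans s<r r≤M))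

*-unitFraction-bounds : ∀ {α} d → 0ℚ Q.< α → α Q.< 1ℚ → 0ℚ Q.< α * unitFraction d × α * unitFraction d Q.< 1ℚ
*-unitFraction-bounds {α} d 0<α α<1 =
  QP.positive⁻¹ (α * unitFraction d) {{QP.pos*pos⇒pos α (unitFraction d)}} ,
  QP.≤-<-trans (QP.≤-trans (QP.*-monoˡ-≤-nonNeg α (unitFraction≤1 d)) (QP.≤-reflexive (QP.*-identityʳ α))) α<1
  where
  instance
    α-pos : Q.Positive α
    α-pos = Q.positive 0<α
    α-nonNeg : Q.NonNegative α
    α-nonNeg = QP.pos⇒nonNeg α

lemma14 : (r s : ℕ) → 1 ≤ s → s < r →
          (α : ℚ) → 0ℚ Q.< α → α Q.< 1ℚ →
          Σ ℚ (λ σ → (0ℚ Q.< σ) × (σ Q.< 1ℚ) ×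
            Σ ℕ (λ n₃ → (0 < n₃) ×
              ((n t : ℕ) → n₃ ≤ n → ℕtoℚ t Q.≤ σ * ℕtoℚ n →
                (ℕtoℚ (N n t r s) - α * ℕtoℚ ((n ∸ s) C (r ∸ s)))
                  Q.< ℕtoℚ (N (n ∸ 1) t r s))))
lemma14 r s _ s<r α 0<α α<1 =
  σ , proj₁ σ-bounds , proj₂ σ-bounds , r ℕ.+ s , ℕP.<-≤-trans (ℕP.≤-<-trans z≤n s<r) (ℕP.m≤m+n r s) ,
  λ n t r+s≤n t≤σn →
    subst (λ j → ι (N n t r s) - α * ι ((n ∸ s) C j) Q.< ι (N (n ∸ 1) t r s)) (sym r∸s≡1+k)
      (N-increment< {n} {r} {s} {k} {t} α σ 0<α (*-unitFraction-cancel α d) r∸s≡1+k s<r r+s≤n t≤σn)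
  where
  k : ℕ
  k = r ∸ suc s
  r∸s≡1+k : r ∸ s ≡ suc k
  r∸s≡1+k = ℕP.+-∸-assoc 1 s<r
  d : ℕ
  d = ℕ.pred (2 ℕ.* suc k)
  σ : ℚ
  σ = α * unitFraction d
  σ-bounds : 0ℚ Q.< σ × σ Q.< 1ℚ
  σ-bounds = *-unitFraction-bounds d 0<α α<1
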